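{- Let $G$ be a graph with $n$ vertices and $m$ edges. The algorithm SPARSE$_3(G)$ described below returns a $3$-path vertex cover $H$ of $G$ with $|H|\le \frac{2n+m}{6}$.
   Context: Graphs are finite and simple. A subset $S\subseteq V(G)$ is a $3$-path vertex cover of $G$ if every path on $3$ vertices in $G$ contains at least one vertex of $S$. Algorithm SPARSE$_3(G)$: set $H:=\emptyset$; while the current graph $G$ contains a vertex $v$ of degree at least $4$, add $v$ to $H$ and remove from $G$ the vertex $v$ and all edges incident with $v$; then (the remaining graph $G'$ having maximum degree at most $3$) add to $H$ a $3$-path vertex cover of $G'$ of size at most $\min\left(\frac{|V(G')|}{2},\frac{|E(G')|}{2}\right)$, computed by a linear time procedure for graphs of maximum degree at most $3$; return $H$. -}

module Defs where

open import Data.Bool using (Bool; true; false; _∧_; if_then_else_)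
open import Data.Nat using (ℕ; _≤_; _*_; _+_; _<ᵇ_)
open import Data.Fin using (Fin; toℕ)
open import Data.Fin.Subset using (Subset; _∈_; _⊆_; _∪_; ⁅_⁆; _-_; ∣_∣)
open import Data.List using (List; length; filter; allFin; concatMap; map)
open import Data.Product using (_×_; _,_; proj₁; proj₂)
open import Data.Sum using (_⊎_)
open import Data.Vec using (lookup)
open import Relation.Binary.PropositionalEquality using (_≡_; _≢_)
open import Relation.Nullary.Decidable using (Dec)
open import Data.Bool.Properties using (T?)
open import Data.Bool using (T)

record Graph (n : ℕ) : Set where
  field
    adj    : Fin n → Fin n → Bool
    sym    : ∀ u v → adj u v ≡ adj v u
    irrefl : ∀ v → adj v v ≡ false
open Graph public

module _ {n : ℕ} (G : Graph n) where

  mem : Subset n → Fin n → Bool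
  mem R v = lookup R v

  degIn : Subset n → Fin n → ℕ
  degIn R v = length (filter (λ u → T? (mem R u ∧ adj G v u)) (allFin n))

  edgesIn : Subset n → ℕ
  edgesIn R = length (filter (λ p → T? (mem R (proj₁ p) ∧ (mem R (proj₂ p)
                        ∧ ((toℕ (proj₁ p) <ᵇ toℕ (proj₂ p)) ∧ adj G (proj₁ p) (proj₂ p)))))
                     (concatMap (λ i → map (λ j → (i , j)) (allFin n)) (allFin n)))

  -- S is a 3-path vertex cover of G[R]: every path a-b-c on three (distinct)
  -- vertices of G[R] contains a vertex of S.  (a ≠ b, b ≠ c follow from irreflexivity.)
  IsPVC3In : Subset n → Subset n → Set
  IsPVC3In R S = ∀ a b c → a ∈ R → b ∈ R → c ∈ R →
                 T (adj G a b) → T (adj G b c) → a ≢ c →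
                 a ∈ S ⊎ (b ∈ S ⊎ c ∈ S)

  -- Sparse3Run R H : H is a possible output of SPARSE_3 started with current
  -- graph G[R] (H collects the vertices chosen from this point on).
  data Sparse3Run : Subset n → Subset n → Set where
    step   : ∀ {R H} (v : Fin n) → v ∈ R → 4 ≤ degIn R v →
             Sparse3Run (R - v) H → Sparse3Run R (⁅ v ⁆ ∪ H)
    finish : ∀ {R S} → (∀ v → v ∈ R → degIn R v ≤ 3) →
             S ⊆ R → IsPVC3In R S →
             2 * ∣ S ∣ ≤ ∣ R ∣ → 2 * ∣ S ∣ ≤ edgesIn R →
             Sparse3Run R S

module Submission where

-- Each greedy step deletes a vertex v of degree d ≥ 4 from the current graph G[R], so the
-- potential 2 |R| + |E(G[R])| drops by 2 + d ≥ 6 while H gains one vertex; the cover S of the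
-- final subcubic graph satisfies 6 |S| = 2 (2 |S|) + 2 |S| ≤ 2 |R| + |E(G[R])|.  A 3-path of
-- G[R] either passes through v or lies in G[R - v], where the later choices cover it.

open import Defs
open import Data.Nat using (ℕ; _≤_; _*_; _+_)
open import Data.Fin.Subset using (Subset; ⊤; ∣_∣)
open import Data.Product using (_×_)

open import Data.Bool using (Bool; true; false; _∧_; _∨_; not)
open import Data.Bool.Properties using (T?; T-≡; ¬-not; ∧-zeroʳ; ∧-identityʳ; ∨-identityʳ)
open import Function.Bundles using (Equivalence)
open import Data.Fin using (Fin; toℕ; zero; suc; _≟_)
open import Data.Fin.Properties using (toℕ-injective)
open import Data.Fin.Subset using (_∈_; _-_; ⁅_⁆; _∪_; outside; inside)
open import Data.Fin.Subset.Properties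
  using (∣⊤∣≡n; ∣⁅x⁆∣≡1; x∈⁅x⁆; x∈p∪q⁺; x∈p∧x≢y⇒x∈p-y; x∈p⇒∣p-x∣<∣p∣; ∣p∣≤∣x∷p∣; p─⊥≡p)
open import Data.List using (List; []; _∷_; _++_; length; filter; map; concatMap; tabulate; allFin)
open import Data.List.Properties using (map-tabulate)
open import Data.Nat using (suc; _<_; _<ᵇ_; z≤n; s≤s)
open import Data.Nat.Properties
  using (<-cmp; <-irrefl; <⇒<ᵇ; <ᵇ⇒<; +-suc; *-suc; *-identityˡ; *-identityʳ; ≤-reflexive; ≤-trans;
         +-mono-≤; +-monoʳ-≤; *-monoʳ-≤; module ≤-Reasoning)
open import Data.Nat.Tactic.RingSolver using (solve-∀)
open import Data.Product using (_,_)
open import Data.Sum using (inj₁; inj₂)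
open import Data.Vec using ([]; _∷_; lookup)
open import Data.Vec.Properties using ([]=⇒lookup)
open import Function using (_∘_; id)
open import Relation.Binary.PropositionalEquality as ≡ hiding (sym)
open import Relation.Nullary using (yes; no; does; ¬_)
open import Relation.Binary.Definitions using (tri<; tri≈; tri>)

private
  variable
    A B : Set

count : (A → Bool) → List A → ℕ
count p xs = length (filter (λ x → T? (p x)) xs)

count-cong : ∀ {p q : A → Bool} → (∀ x → p x ≡ q x) → ∀ xs → count p xs ≡ count q xs
count-cong p≗q [] = refl
count-cong {p = p} {q = q} p≗q (x ∷ xs) with p x | q x | p≗q x
... | true  | true  | refl = cong suc (count-cong p≗q xs)
... | false | false | refl = count-cong p≗q xs

count-++ : ∀ (p : A → Bool) xs ys → count p (xs ++ ys) ≡ count p xs + count p ys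
count-++ p []       ys = refl
count-++ p (x ∷ xs) ys with p x
... | true  = cong suc (count-++ p xs ys)
... | false = count-++ p xs ys

count-∨ : ∀ (p q : A → Bool) → (∀ x → p x ∧ q x ≡ false) →
          ∀ xs → count (λ x → p x ∨ q x) xs ≡ count p xs + count q xs
count-∨ p q disjoint [] = refl
count-∨ p q disjoint (x ∷ xs) with p x | q x | disjoint x
... | true  | true  | ()
... | true  | false | _ = cong suc (count-∨ p q disjoint xs)
... | false | true  | _ = trans (cong suc (count-∨ p q disjoint xs)) (≡.sym (+-suc _ _))
... | false | false | _ = count-∨ p q disjoint xs

count-false : ∀ xs → count {A = A} (λ _ → false) xs ≡ 0
count-false []       = refl
count-false (x ∷ xs) = count-false xs

count-map : ∀ (p : B → Bool) (f : A → B) xs → count p (map f xs) ≡ count (p ∘ f) xs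
count-map p f []       = refl
count-map p f (x ∷ xs) with p (f x)
... | true  = cong suc (count-map p f xs)
... | false = count-map p f xs

pairs : List A → List B → List (A × B)
pairs is js = concatMap (λ i → map (i ,_) js) is

_⊗_ : (A → Bool) → (B → Bool) → A × B → Bool
(p ⊗ q) (i , j) = p i ∧ q j

count-⊗ : ∀ (p : A → Bool) (q : B → Bool) is js →
          count (p ⊗ q) (pairs is js) ≡ count p is * count q js
count-⊗ p q []       js = refl
count-⊗ p q (i ∷ is) js = begin
  count (p ⊗ q) (map (i ,_) js ++ pairs is js)
    ≡⟨ count-++ (p ⊗ q) (map (i ,_) js) (pairs is js) ⟩
  count (p ⊗ q) (map (i ,_) js) + count (p ⊗ q) (pairs is js)
    ≡⟨ cong₂ _+_ (count-map (p ⊗ q) (i ,_) js) (count-⊗ p q is js) ⟩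
  count (λ j → p i ∧ q j) js + count p is * count q js
    ≡⟨ row ⟩
  count p (i ∷ is) * count q js ∎
  where
  open ≡-Reasoning
  row : count (λ j → p i ∧ q j) js + count p is * count q js ≡ count p (i ∷ is) * count q js
  row with p i
  ... | true  = refl
  ... | false = cong (_+ count p is * count q js) (count-false js)

count-tabulate : ∀ {n} (p : A → Bool) (f : Fin n → A) →
                 count p (tabulate f) ≡ count (p ∘ f) (allFin n)
count-tabulate {n = n} p f = begin
  count p (tabulate f)          ≡⟨ cong (count p) (≡.sym (map-tabulate id f)) ⟩
  count p (map f (allFin n))    ≡⟨ count-map p f (allFin n) ⟩
  count (p ∘ f) (allFin n)      ∎
  where open ≡-Reasoning

_≡ᵇ_ : ∀ {n} → Fin n → Fin n → Bool
i ≡ᵇ v = does (i ≟ v)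

count-≡ᵇ : ∀ {n} (v : Fin n) → count (_≡ᵇ v) (allFin n) ≡ 1
count-≡ᵇ {suc n} zero    =
  cong suc (trans (count-tabulate {n = n} (_≡ᵇ zero) suc) (count-false (allFin n)))
count-≡ᵇ {suc n} (suc v) = trans (count-tabulate {n = n} (_≡ᵇ suc v) suc) (count-≡ᵇ v)

<ᵇ-true : ∀ {m n} → m < n → (m <ᵇ n) ≡ true
<ᵇ-true m<n = Equivalence.to T-≡ (<⇒<ᵇ m<n)

<ᵇ-false : ∀ {m n} → ¬ m < n → (m <ᵇ n) ≡ false
<ᵇ-false {m} {n} m≮n = ¬-not (m≮n ∘ <ᵇ⇒< m n ∘ Equivalence.from T-≡)

<ᵇ-irrefl : ∀ m → (m <ᵇ m) ≡ false
<ᵇ-irrefl m = <ᵇ-false {m} (<-irrefl refl)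

lookup-p-y : ∀ {n} (p : Subset n) (x y : Fin n) → lookup (p - y) x ≡ not (x ≡ᵇ y) ∧ lookup p x
lookup-p-y (s ∷ p) zero    zero    = refl
lookup-p-y (s ∷ p) zero    (suc y) = refl
lookup-p-y (s ∷ p) (suc x) zero    = cong (λ q → lookup q x) (p─⊥≡p p)
lookup-p-y (s ∷ p) (suc x) (suc y) = lookup-p-y p x y

∣p∪q∣≤∣p∣+∣q∣ : ∀ {n} (p q : Subset n) → ∣ p ∪ q ∣ ≤ ∣ p ∣ + ∣ q ∣
∣p∪q∣≤∣p∣+∣q∣ []            []            = z≤n
∣p∪q∣≤∣p∣+∣q∣ (inside  ∷ p) (s       ∷ q) =
  s≤s (≤-trans (∣p∪q∣≤∣p∣+∣q∣ p q) (+-monoʳ-≤ ∣ p ∣ (∣p∣≤∣x∷p∣ s q)))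
∣p∪q∣≤∣p∣+∣q∣ (outside ∷ p) (inside  ∷ q) =
  ≤-trans (s≤s (∣p∪q∣≤∣p∣+∣q∣ p q)) (≤-reflexive (≡.sym (+-suc ∣ p ∣ ∣ q ∣)))
∣p∪q∣≤∣p∣+∣q∣ (outside ∷ p) (outside ∷ q) = ∣p∪q∣≤∣p∣+∣q∣ p q

module _ {n : ℕ} (G : Graph n) where

  isEdgeIn : Subset n → Fin n × Fin n → Bool
  isEdgeIn R (i , j) = mem G R i ∧ (mem G R j ∧ ((toℕ i <ᵇ toℕ j) ∧ adj G i j))

  upperNbr lowerNbr : Subset n → Fin n → Fin n → Bool
  upperNbr R v u = mem G R u ∧ ((toℕ v <ᵇ toℕ u) ∧ adj G v u)
  lowerNbr R v u = mem G R u ∧ ((toℕ u <ᵇ toℕ v) ∧ adj G u v)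

  adj-split : ∀ R v u → mem G R u ∧ adj G v u ≡ upperNbr R v u ∨ lowerNbr R v u
  adj-split R v u with mem G R u | <-cmp (toℕ u) (toℕ v)
  ... | false | _ = refl
  ... | true  | tri< u<v _ v≮u rewrite <ᵇ-false v≮u | <ᵇ-true u<v = Graph.sym G v u
  ... | true  | tri> u≮v _ v<u rewrite <ᵇ-false u≮v | <ᵇ-true v<u = ≡.sym (∨-identityʳ _)
  ... | true  | tri≈ _ u≡v _ with toℕ-injective u≡v
  ...   | refl rewrite <ᵇ-irrefl (toℕ v) = irrefl G v

  upper-lower-disjoint : ∀ R v u → upperNbr R v u ∧ lowerNbr R v u ≡ false
  upper-lower-disjoint R v u with mem G R u | <-cmp (toℕ u) (toℕ v)
  ... | false | _ = refl
  ... | true  | tri< _ _ v≮u rewrite <ᵇ-false v≮u = refl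
  ... | true  | tri> u≮v _ _ rewrite <ᵇ-false u≮v = ∧-zeroʳ _
  ... | true  | tri≈ _ u≡v _ with toℕ-injective u≡v
  ...   | refl rewrite <ᵇ-irrefl (toℕ v) = refl

  degIn-split : ∀ R v → degIn G R v ≡ count (upperNbr R v) (allFin n) + count (lowerNbr R v) (allFin n)
  degIn-split R v = trans (count-cong (adj-split R v) (allFin n))
                          (count-∨ (upperNbr R v) (lowerNbr R v) (upper-lower-disjoint R v) (allFin n))

  -- edgesIn lists each edge once, as a pair (i , j) with i < j, so an edge at v has v as
  -- its first coordinate (and its other end above v) or as its second (other end below v).
  upperEdgesAt lowerEdgesAt edgesAt : Subset n → Fin n → Fin n × Fin n → Bool
  upperEdgesAt R v = (_≡ᵇ v) ⊗ upperNbr R v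
  lowerEdgesAt R v = lowerNbr R v ⊗ (_≡ᵇ v)
  edgesAt R v x = upperEdgesAt R v x ∨ lowerEdgesAt R v x

  isEdgeIn-split : ∀ R v → mem G R v ≡ true →
                   ∀ x → isEdgeIn R x ≡ isEdgeIn (R - v) x ∨ edgesAt R v x
  isEdgeIn-split R v v∈R (i , j) rewrite lookup-p-y R i v | lookup-p-y R j v with i ≟ v | j ≟ v
  ... | yes refl | yes refl rewrite v∈R | <ᵇ-irrefl (toℕ v) = refl
  ... | yes refl | no _     rewrite ∧-zeroʳ (lowerNbr R v v) | v∈R = ≡.sym (∨-identityʳ _)
  ... | no _     | yes refl rewrite ∧-identityʳ (lowerNbr R v i) | v∈R | ∧-zeroʳ (mem G R i) = refl
  ... | no _     | no _     rewrite ∧-zeroʳ (lowerNbr R v i) = ≡.sym (∨-identityʳ _)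

  edges-disjoint : ∀ R v x → isEdgeIn (R - v) x ∧ edgesAt R v x ≡ false
  edges-disjoint R v (i , j) rewrite lookup-p-y R i v | lookup-p-y R j v with i ≟ v | j ≟ v
  ... | yes refl | _        = refl
  ... | no _     | yes refl = cong (_∧ (lowerNbr R v i ∧ true)) (∧-zeroʳ (mem G R i))
  ... | no _     | no _     rewrite ∧-zeroʳ (lowerNbr R v i) = ∧-zeroʳ _

  edgesAt-disjoint : ∀ R v x → upperEdgesAt R v x ∧ lowerEdgesAt R v x ≡ false
  edgesAt-disjoint R v (i , j) with i ≟ v | j ≟ v
  ... | yes refl | yes refl rewrite <ᵇ-irrefl (toℕ v) | ∧-zeroʳ (mem G R v) = refl
  ... | yes refl | no _     rewrite ∧-zeroʳ (lowerNbr R v v) = ∧-zeroʳ _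
  ... | no _     | _        = refl

  count-edgesAt : ∀ R v → count (edgesAt R v) (pairs (allFin n) (allFin n)) ≡ degIn G R v
  count-edgesAt R v = begin
    count (edgesAt R v) (pairs vs vs)
      ≡⟨ count-∨ _ _ (edgesAt-disjoint R v) (pairs vs vs) ⟩
    count (upperEdgesAt R v) (pairs vs vs) + count (lowerEdgesAt R v) (pairs vs vs)
      ≡⟨ cong₂ _+_ (count-⊗ (_≡ᵇ v) (upperNbr R v) vs vs) (count-⊗ (lowerNbr R v) (_≡ᵇ v) vs vs) ⟩
    count (_≡ᵇ v) vs * up + low * count (_≡ᵇ v) vs
      ≡⟨ cong₂ (λ k l → k * up + low * l) (count-≡ᵇ v) (count-≡ᵇ v) ⟩
    1 * up + low * 1
      ≡⟨ cong₂ _+_ (*-identityˡ up) (*-identityʳ low) ⟩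
    up + low
      ≡⟨ degIn-split R v ⟨
    degIn G R v ∎
    where
    open ≡-Reasoning
    vs : List (Fin n)
    vs = allFin n
    up low : ℕ
    up  = count (upperNbr R v) vs
    low = count (lowerNbr R v) vs

  edgesIn-remove : ∀ {R v} → v ∈ R → edgesIn G R ≡ edgesIn G (R - v) + degIn G R v
  edgesIn-remove {R} {v} v∈R = begin
    edgesIn G R
      ≡⟨⟩
    count (isEdgeIn R) P
      ≡⟨ count-cong (isEdgeIn-split R v ([]=⇒lookup v∈R)) P ⟩
    count (λ x → isEdgeIn (R - v) x ∨ edgesAt R v x) P
      ≡⟨ count-∨ _ _ (edges-disjoint R v) P ⟩
    edgesIn G (R - v) + count (edgesAt R v) P
      ≡⟨ cong (edgesIn G (R - v) +_) (count-edgesAt R v) ⟩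
    edgesIn G (R - v) + degIn G R v ∎
    where
    open ≡-Reasoning
    P : List (Fin n × Fin n)
    P = pairs (allFin n) (allFin n)

  IsPVC3In-remove : ∀ {R H} v → IsPVC3In G (R - v) H → IsPVC3In G R (⁅ v ⁆ ∪ H)
  IsPVC3In-remove v cover a b c a∈R b∈R c∈R ab bc a≢c with a ≟ v | b ≟ v | c ≟ v
  ... | yes refl | _        | _        = inj₁ (x∈p∪q⁺ (inj₁ (x∈⁅x⁆ a)))
  ... | no _     | yes refl | _        = inj₂ (inj₁ (x∈p∪q⁺ (inj₁ (x∈⁅x⁆ b))))
  ... | no _     | no _     | yes refl = inj₂ (inj₂ (x∈p∪q⁺ (inj₁ (x∈⁅x⁆ c))))
  ... | no a≢v   | no b≢v   | no c≢v
    with cover a b c (x∈p∧x≢y⇒x∈p-y a∈R a≢v) (x∈p∧x≢y⇒x∈p-y b∈R b≢v) (x∈p∧x≢y⇒x∈p-y c∈R c≢v)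
               ab bc a≢c
  ...   | inj₁ a∈H        = inj₁ (x∈p∪q⁺ (inj₂ a∈H))
  ...   | inj₂ (inj₁ b∈H) = inj₂ (inj₁ (x∈p∪q⁺ (inj₂ b∈H)))
  ...   | inj₂ (inj₂ c∈H) = inj₂ (inj₂ (x∈p∪q⁺ (inj₂ c∈H)))

  Sparse3Run⇒IsPVC3In : ∀ {R H} → Sparse3Run G R H → IsPVC3In G R H
  Sparse3Run⇒IsPVC3In (step v _ _ run)       = IsPVC3In-remove v (Sparse3Run⇒IsPVC3In run)
  Sparse3Run⇒IsPVC3In (finish _ _ cover _ _) = cover

  Sparse3Run-size : ∀ {R H} → Sparse3Run G R H → 6 * ∣ H ∣ ≤ 2 * ∣ R ∣ + edgesIn G R
  Sparse3Run-size {R} {S} (finish _ _ _ 2∣S∣≤∣R∣ 2∣S∣≤m) = begin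
    6 * ∣ S ∣                   ≡⟨ 6*s≡2*[2*s]+2*s ∣ S ∣ ⟩
    2 * (2 * ∣ S ∣) + 2 * ∣ S ∣   ≤⟨ +-mono-≤ (*-monoʳ-≤ 2 2∣S∣≤∣R∣) 2∣S∣≤m ⟩
    2 * ∣ R ∣ + edgesIn G R     ∎
    where
    open ≤-Reasoning
    6*s≡2*[2*s]+2*s : ∀ s → 6 * s ≡ 2 * (2 * s) + 2 * s
    6*s≡2*[2*s]+2*s = solve-∀
  Sparse3Run-size {R} (step {H = H} v v∈R 4≤deg run) = begin
    6 * ∣ ⁅ v ⁆ ∪ H ∣
      ≤⟨ *-monoʳ-≤ 6 ∣⁅v⁆∪H∣≤1+∣H∣ ⟩
    6 * suc ∣ H ∣
      ≡⟨ *-suc 6 ∣ H ∣ ⟩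
    6 + 6 * ∣ H ∣
      ≤⟨ +-monoʳ-≤ 6 (Sparse3Run-size run) ⟩
    6 + (2 * r + m)
      ≡⟨ regroup r m ⟩
    2 * suc r + (m + 4)
      ≤⟨ +-mono-≤ (*-monoʳ-≤ 2 (x∈p⇒∣p-x∣<∣p∣ v∈R)) (+-monoʳ-≤ m 4≤deg) ⟩
    2 * ∣ R ∣ + (m + degIn G R v)
      ≡⟨ cong (2 * ∣ R ∣ +_) (edgesIn-remove v∈R) ⟨
    2 * ∣ R ∣ + edgesIn G R ∎
    where
    open ≤-Reasoning
    regroup : ∀ r m → 6 + (2 * r + m) ≡ 2 * suc r + (m + 4)
    regroup = solve-∀
    r m : ℕ
    r = ∣ R - v ∣
    m = edgesIn G (R - v)
    ∣⁅v⁆∪H∣≤1+∣H∣ : ∣ ⁅ v ⁆ ∪ H ∣ ≤ suc ∣ H ∣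
    ∣⁅v⁆∪H∣≤1+∣H∣ =
      ≤-trans (∣p∪q∣≤∣p∣+∣q∣ ⁅ v ⁆ H) (≤-reflexive (cong (_+ ∣ H ∣) (∣⁅x⁆∣≡1 v)))

theorem7 : (n : ℕ) (G : Graph n) (H : Subset n) →
    Sparse3Run G ⊤ H →
    IsPVC3In G ⊤ H × 6 * ∣ H ∣ ≤ 2 * n + edgesIn G ⊤
theorem7 n G H run =
  Sparse3Run⇒IsPVC3In G run ,
  subst (λ k → 6 * ∣ H ∣ ≤ 2 * k + edgesIn G ⊤) (∣⊤∣≡n n) (Sparse3Run-size G run)
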